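{- Let $G$ be a finite simple graph and $x$ a $p$-simplex of $G$. Let $\mathrm{deg}_p(x)$ be the number of $(p+1)$-simplices of $G$ containing $x$. Then for $p>0$, $\mathrm{deg}_p(x)=L_p(x,x)-(p+1)$, and for $p=0$, $\mathrm{deg}_0(x)=L_0(x,x)$.
   Context: A $k$-simplex of $G$ is a complete subgraph with $k+1$ vertices; $v_k$ is their number. Fix an orientation of each simplex; $\Omega_k\cong\mathbb{R}^{v_k}$ (standard basis indexed by $k$-simplices) is the space of antisymmetric functions on oriented $k$-simplices. The exterior derivative $d_k:\Omega_k\to\Omega_{k+1}$ is $(d_kf)(x_0,\dots,x_{k+1})=\sum_{i=0}^{k+1}(-1)^i f(x_0,\dots,\hat{x}_i,\dots,x_{k+1})$, with $d_{ -1}=0$. The Laplacian on $p$-forms is $L_p=d_p^*d_p+d_{p-1}d_{p-1}^*$, a $v_p\times v_p$ matrix, and $L_p(x,x)$ is its diagonal entry at $x$. -}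

module Defs where

open import Data.Bool using (Bool; true; false; _∧_; if_then_else_)
open import Data.Nat using (ℕ; zero; suc)
open import Data.Fin using (Fin; zero; suc)
import Data.Fin as Fin
open import Data.Integer using (ℤ; +_; -_; _+_; _*_)
open import Data.List using (List; []; _∷_; _++_; map; foldr; filter; length)
open import Data.Bool.ListAction using (all; any)
import Data.List as List
open import Data.Vec using (Vec; []; _∷_; removeAt; toList)
import Data.Vec as Vec
import Data.Vec.Properties as VecP
open import Relation.Nullary.Decidable using (does)
import Relation.Nullary.Decidable
import Data.Bool
open import Relation.Binary.PropositionalEquality using (_≡_)

record Graph (n : ℕ) : Set where
  field
    adj    : Fin n → Fin n → Bool
    sym    : ∀ i j → adj i j ≡ adj j i
    irrefl : ∀ i → adj i i ≡ false
open Graph public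

-- All strictly increasing vectors of length m with entries in Fin n
-- (i.e. all m-element vertex sets, each listed in increasing order).
incVecs : (n m : ℕ) → List (Vec (Fin n) m)
incVecs n       zero    = [] ∷ []
incVecs zero    (suc m) = []
incVecs (suc n) (suc m) =
  map (λ v → zero ∷ Vec.map suc v) (incVecs n m)
  ++ map (Vec.map suc) (incVecs n (suc m))

cliqueB : ∀ {n} → Graph n → List (Fin n) → Bool
cliqueB G []       = true
cliqueB G (v ∷ vs) = all (adj G v) vs ∧ cliqueB G vs

-- Each simplex is represented by its vertices in increasing order;
-- this fixes the orientation of each simplex.  The list is duplicate-free
-- and indexes the standard basis of Ω_k (so v_k = length (simplices G k)).
simplices : ∀ {n} → Graph n → (k : ℕ) → List (Vec (Fin n) (suc k))
simplices {n} G k = filter (λ v → cliqueB G (toList v) Data.Bool.≟ true) (incVecs n (suc k))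

_≟ᵥ_ : ∀ {n m} (u v : Vec (Fin n) m) → Relation.Nullary.Decidable.Dec (u ≡ v)
_≟ᵥ_ = VecP.≡-dec Fin._≟_

Σℤ : List ℤ → ℤ
Σℤ = foldr _+_ (+ 0)

sgn : ℕ → ℤ
sgn zero          = + 1
sgn (suc zero)    = - (+ 1)
sgn (suc (suc i)) = sgn i

-- k-forms: functions on oriented k-simplices (vectors of k+1 vertices in
-- increasing order); only their values on the simplices of G matter.
Ω : ℕ → ℕ → Set
Ω n k = Vec (Fin n) (suc k) → ℤ

δ : ∀ {n k} → Vec (Fin n) (suc k) → Ω n k
δ x y = if does (x ≟ᵥ y) then + 1 else + 0

dExt : ∀ {n} (k : ℕ) → Ω n k → Ω n (suc k)
dExt k f z = Σℤ (map (λ i → sgn (Fin.toℕ i) * f (removeAt z i)) (List.allFin (suc (suc k))))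

dMat : ∀ {n} (k : ℕ) → Vec (Fin n) (suc (suc k)) → Vec (Fin n) (suc k) → ℤ
dMat k z x = dExt k (δ x) z

-- Adjoint d_k^* : Ω_{k+1} → Ω_k w.r.t. the standard inner product
-- (standard basis indexed by the simplices of G), i.e. the transpose matrix.
dAdj : ∀ {n} → Graph n → (k : ℕ) → Ω n (suc k) → Ω n k
dAdj G k g x = Σℤ (map (λ z → dMat k z x * g z) (simplices G (suc k)))

-- Restriction of a form to the simplices of G (Ω_k ≅ ℝ^{v_k}).
restrict : ∀ {n} → Graph n → (k : ℕ) → Ω n k → Ω n k
restrict G k f x = Σℤ (map (λ y → δ y x * f y) (simplices G k))

-- Hodge Laplacian L_p = d_p^* d_p + d_{p-1} d_{p-1}^*, with d_{-1} = 0.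
Lap : ∀ {n} → Graph n → (p : ℕ) → Ω n p → Ω n p
Lap G zero    f = dAdj G zero (dExt zero (restrict G zero f))
Lap G (suc q) f x =
  dAdj G (suc q) (dExt (suc q) (restrict G (suc q) f)) x
  + dExt q (dAdj G q (restrict G (suc q) f)) x

Ldiag : ∀ {n} → Graph n → (p : ℕ) → Vec (Fin n) (suc p) → ℤ
Ldiag G p x = Lap G p (δ x) x

subB : ∀ {n a b} → Vec (Fin n) a → Vec (Fin n) b → Bool
subB x y = all (λ v → any (λ w → does (v Fin.≟ w)) (toList y)) (toList x)

deg : ∀ {n} → Graph n → (p : ℕ) → Vec (Fin n) (suc p) → ℕ
deg G p x = length (filter (λ z → subB x z Data.Bool.≟ true) (simplices G (suc p)))

module Submission where

-- The diagonal entry splits as L_p(x,x) = Σ_z d_p(z,x)² + Σ_y d_{p-1}(x,y)².  Since every simplex is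
-- listed in increasing order, d_p(z,x) is (-1)^i when x is z with its i-th vertex removed and 0 otherwise,
-- and for increasing vectors "x ⊆ z with one vertex fewer" means exactly "x is such a facet of z".  So the
-- first sum counts the (p+1)-simplices containing x, while the second runs over the p+1 facets of x and
-- contributes 1 for each of them.

open import Defs hiding (sym; irrefl)
open import Data.Bool using (Bool; true; false; if_then_else_; T)
import Data.Bool
open import Data.Bool.Properties using (T-≡)
open import Data.Nat as ℕ using (ℕ; zero; suc; z≤n; s≤s; z<s; s<s; _>_)
import Data.Nat.Properties as ℕ
open import Data.Fin as Fin using (Fin; toℕ)
import Data.Fin.Properties as Fin
open import Data.Vec using (Vec; []; _∷_; removeAt; toList)
import Data.Vec as Vec
open import Data.Integer using (ℤ; +_; _+_; _*_; _-_)
import Data.Integer.Properties as ℤ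
open import Algebra.Properties.AbelianGroup ℤ.+-0-abelianGroup using (//-rightDividesʳ)
open import Data.List using (List; []; _∷_; map; filter; length)
import Data.List as List
import Data.List.Properties as List
open import Data.List.Membership.Propositional using (_∈_)
open import Data.List.Membership.Propositional.Properties using (∈-map⁻; ∈-++⁻; ∈-filter⁻; ∈-allFin)
open import Data.List.Relation.Binary.Subset.Propositional using (_⊆_)
open import Data.List.Relation.Binary.Subset.Propositional.Properties using (xs⊆x∷xs; ∷⁺ʳ)
open import Data.List.Relation.Unary.Any as Any using (here; there)
open import Data.List.Relation.Unary.All as All using (All; []; _∷_)
open import Data.List.Relation.Unary.All.Properties using (all⁺; all⁻)
open import Data.List.Relation.Unary.Any.Properties using (any⁺; any⁻)
open import Data.List.Relation.Unary.AllPairs as AllPairs using (AllPairs; []; _∷_)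
open import Data.List.Relation.Unary.Unique.Propositional using (Unique)
import Data.List.Relation.Unary.Unique.Propositional.Properties as Unique
open import Data.Product using (_×_; _,_; ∃; proj₁)
open import Data.Sum using (_⊎_; inj₁; inj₂)
open import Data.Empty using (⊥-elim)
open import Function using (_∘_; id; Injective)
open import Function.Bundles using (Equivalence)
open import Relation.Nullary using (¬_; yes; no; does)
open import Relation.Binary using (DecidableEquality; IsStrictTotalOrder; tri<; tri≈; tri>)
open import Relation.Binary.PropositionalEquality

Σℤ-cong : ∀ {A : Set} (S : List A) {f g : A → ℤ} →
          (∀ {z} → z ∈ S → f z ≡ g z) → Σℤ (map f S) ≡ Σℤ (map g S)
Σℤ-cong []      f≡g = refl
Σℤ-cong (z ∷ S) f≡g = cong₂ _+_ (f≡g (here refl)) (Σℤ-cong S (f≡g ∘ there))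

Σℤ-zero : ∀ {A : Set} (S : List A) {f : A → ℤ} → (∀ {z} → z ∈ S → f z ≡ + 0) → Σℤ (map f S) ≡ + 0
Σℤ-zero []      f≡0 = refl
Σℤ-zero (z ∷ S) f≡0 = cong₂ _+_ (f≡0 (here refl)) (Σℤ-zero S (f≡0 ∘ there))

Σℤ-ones : ∀ {A : Set} (S : List A) → Σℤ (map (λ _ → + 1) S) ≡ + length S
Σℤ-ones []      = refl
Σℤ-ones (_ ∷ S) rewrite Σℤ-ones S = refl

Σℤ-indicator : ∀ {A : Set} (P : A → Bool) (S : List A) →
  Σℤ (map (λ z → if P z then + 1 else + 0) S) ≡ + length (filter (λ z → P z Data.Bool.≟ true) S)
Σℤ-indicator P []      = refl
Σℤ-indicator P (z ∷ S) with P z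
... | true  rewrite Σℤ-indicator P S = refl
... | false rewrite Σℤ-indicator P S = refl

kronecker : ∀ {A : Set} → DecidableEquality A → A → A → ℤ
kronecker _≟_ x y = if does (x ≟ y) then + 1 else + 0

module _ {A : Set} (_≟_ : DecidableEquality A) where

  kronecker-≢ : ∀ {x y} → x ≢ y → kronecker _≟_ x y ≡ + 0
  kronecker-≢ {x} {y} x≢y with x ≟ y
  ... | yes x≡y = ⊥-elim (x≢y x≡y)
  ... | no  _   = refl

  kronecker-refl : ∀ x → kronecker _≟_ x x ≡ + 1
  kronecker-refl x with x ≟ x
  ... | yes _   = refl
  ... | no  x≢x = ⊥-elim (x≢x refl)

  Σℤ-kronecker : (h : A → ℤ) {x : A} (S : List A) → Unique S → x ∈ S →
                 Σℤ (map (λ z → h z * kronecker _≟_ x z) S) ≡ h x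
  Σℤ-kronecker h {x} (_ ∷ S) (x∉S ∷ _) (here refl) = begin
    h x * kronecker _≟_ x x + Σℤ (map (λ z → h z * kronecker _≟_ x z) S)
      ≡⟨ cong₂ _+_ (cong (h x *_) (kronecker-refl x)) (Σℤ-zero S λ {z} z∈S →
           trans (cong (h z *_) (kronecker-≢ (All.lookup x∉S z∈S))) (ℤ.*-zeroʳ (h z))) ⟩
    h x * + 1 + + 0 ≡⟨ ℤ.+-identityʳ _ ⟩
    h x * + 1       ≡⟨ ℤ.*-identityʳ (h x) ⟩
    h x             ∎
    where open ≡-Reasoning
  Σℤ-kronecker h {x} (y ∷ S) (y∉S ∷ S!) (there x∈S) = begin
    h y * kronecker _≟_ x y + Σℤ (map (λ z → h z * kronecker _≟_ x z) S)
      ≡⟨ cong₂ _+_ (cong (h y *_) (kronecker-≢ (λ x≡y → All.lookup y∉S x∈S (sym x≡y))))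
                   (Σℤ-kronecker h S S! x∈S) ⟩
    h y * + 0 + h x ≡⟨ cong (_+ h x) (ℤ.*-zeroʳ (h y)) ⟩
    + 0 + h x       ≡⟨ ℤ.+-identityˡ (h x) ⟩
    h x             ∎
    where open ≡-Reasoning

Σℤ-kronecker-injective : ∀ {A : Set} (_≟_ : DecidableEquality A) {m} (r : Fin m → A) →
  Injective _≡_ _≡_ r → (c : Fin m → ℤ) (i : Fin m) →
  Σℤ (map (λ j → c j * kronecker _≟_ (r i) (r j)) (List.allFin m)) ≡ c i
Σℤ-kronecker-injective _≟_ {m} r r-inj c i =
  trans (Σℤ-cong (List.allFin m) (λ {j} _ → cong (c j *_) (kronecker-image j)))
        (Σℤ-kronecker Fin._≟_ c (List.allFin m) (Unique.allFin⁺ m) (∈-allFin i))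
  where
  kronecker-image : ∀ j → kronecker _≟_ (r i) (r j) ≡ kronecker Fin._≟_ i j
  kronecker-image j with r i ≟ r j | i Fin.≟ j
  ... | yes _     | yes _    = refl
  ... | no  _     | no  _    = refl
  ... | yes ri≡rj | no  i≢j  = ⊥-elim (i≢j (r-inj ri≡rj))
  ... | no  ri≢rj | yes refl = ⊥-elim (ri≢rj refl)

sgn-*-sgn : ∀ i → sgn i * sgn i ≡ + 1
sgn-*-sgn zero          = refl
sgn-*-sgn (suc zero)    = refl
sgn-*-sgn (suc (suc i)) = sgn-*-sgn i

_⊆ᵛ_ : ∀ {A : Set} {m k} → Vec A m → Vec A k → Set
x ⊆ᵛ z = toList x ⊆ toList z

removeAt-⊆ᵛ : ∀ {A : Set} {m} (z : Vec A (suc m)) i → removeAt z i ⊆ᵛ z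
removeAt-⊆ᵛ (a ∷ z)           Fin.zero    = xs⊆x∷xs (toList z) a
removeAt-⊆ᵛ (a ∷ z@(_ ∷ _)) (Fin.suc i) = ∷⁺ʳ a (removeAt-⊆ᵛ z i)

module _ {n : ℕ} where

  private
    T-does⇒≡ : {v w : Fin n} → T (does (v Fin.≟ w)) → v ≡ w
    T-does⇒≡ {v} {w} t with v Fin.≟ w
    ... | yes v≡w = v≡w

    ≡⇒T-does : {v w : Fin n} → v ≡ w → T (does (v Fin.≟ w))
    ≡⇒T-does {v} refl with v Fin.≟ v
    ... | yes _   = _
    ... | no  v≢v = v≢v refl

  subB-sound : ∀ {m k} (x : Vec (Fin n) m) (z : Vec (Fin n) k) → subB x z ≡ true → x ⊆ᵛ z
  subB-sound x z x⊆z v∈x =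
    Any.map T-does⇒≡ (any⁻ _ (toList z) (All.lookup (all⁺ _ (toList x) (Equivalence.from T-≡ x⊆z)) v∈x))

  subB-complete : ∀ {m k} (x : Vec (Fin n) m) (z : Vec (Fin n) k) → x ⊆ᵛ z → subB x z ≡ true
  subB-complete x z x⊆z =
    Equivalence.to T-≡ (all⁻ _ (All.tabulate λ v∈x → any⁺ _ (Any.map ≡⇒T-does (x⊆z v∈x))))

  subB-false⇒⊈ᵛ : ∀ {m k} (x : Vec (Fin n) m) (z : Vec (Fin n) k) → subB x z ≡ false → ¬ x ⊆ᵛ z
  subB-false⇒⊈ᵛ x z x⊈z x⊆z with trans (sym x⊈z) (subB-complete x z x⊆z)
  ... | ()

module SortedVec {A : Set} {_<_ : A → A → Set} (<-sto : IsStrictTotalOrder _≡_ _<_) where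

  open IsStrictTotalOrder <-sto using (compare; irrefl) renaming (trans to <-trans)

  Increasing : ∀ {m} → Vec A m → Set
  Increasing x = AllPairs _<_ (toList x)

  private
    ⊆ᵛ-drop-head : ∀ {m k a} {x : Vec A m} {z : Vec A k} →
                   All (a <_) (toList x) → x ⊆ᵛ (a ∷ z) → x ⊆ᵛ z
    ⊆ᵛ-drop-head a<x x⊆az v∈x with x⊆az v∈x
    ... | here refl = ⊥-elim (irrefl refl (All.lookup a<x v∈x))
    ... | there v∈z = v∈z

    ⊆ᵛ-step : ∀ {m k a b} {x : Vec A m} {z : Vec A k} → Increasing (b ∷ x) → Increasing (a ∷ z) →
              (b ∷ x) ⊆ᵛ (a ∷ z) → (b ≡ a × x ⊆ᵛ z) ⊎ (b ∷ x) ⊆ᵛ z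
    ⊆ᵛ-step {a = a} {b} (b<x ∷ _) (a<z ∷ _) bx⊆az with compare b a
    ... | tri≈ _ refl _ = inj₁ (refl , ⊆ᵛ-drop-head b<x (bx⊆az ∘ there))
    ... | tri> _ _ a<b  = inj₂ (⊆ᵛ-drop-head (a<b ∷ All.map (<-trans a<b) b<x) bx⊆az)
    ... | tri< b<a _ _ with bx⊆az (here refl)
    ...   | here b≡a   = ⊥-elim (irrefl b≡a b<a)
    ...   | there b∈z  = ⊥-elim (irrefl refl (<-trans b<a (All.lookup a<z b∈z)))

  ⊆ᵛ⇒≤ : ∀ {m k} {x : Vec A m} {z : Vec A k} → Increasing x → Increasing z → x ⊆ᵛ z → m ℕ.≤ k
  ⊆ᵛ⇒≤ {x = []}                _   _   _     = z≤n
  ⊆ᵛ⇒≤ {x = b ∷ x} {z = []}    _   _   bx⊆[] with bx⊆[] (here refl)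
  ... | ()
  ⊆ᵛ⇒≤ {x = b ∷ x} {z = a ∷ z} bx↑ az↑ bx⊆az with ⊆ᵛ-step bx↑ az↑ bx⊆az
  ... | inj₁ (_ , x⊆z) = s≤s (⊆ᵛ⇒≤ (AllPairs.tail bx↑) (AllPairs.tail az↑) x⊆z)
  ... | inj₂ bx⊆z      = ℕ.m≤n⇒m≤1+n (⊆ᵛ⇒≤ bx↑ (AllPairs.tail az↑) bx⊆z)

  ⊆ᵛ⇒≡ : ∀ {m} {x z : Vec A m} → Increasing x → Increasing z → x ⊆ᵛ z → x ≡ z
  ⊆ᵛ⇒≡ {x = []}    {[]}    _   _   _     = refl
  ⊆ᵛ⇒≡ {x = b ∷ x} {a ∷ z} bx↑ az↑ bx⊆az with ⊆ᵛ-step bx↑ az↑ bx⊆az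
  ... | inj₁ (refl , x⊆z) = cong (b ∷_) (⊆ᵛ⇒≡ (AllPairs.tail bx↑) (AllPairs.tail az↑) x⊆z)
  ... | inj₂ bx⊆z         = ⊥-elim (ℕ.1+n≰n (⊆ᵛ⇒≤ bx↑ (AllPairs.tail az↑) bx⊆z))

  ⊆ᵛ⇒removeAt : ∀ {m} {x : Vec A m} {z : Vec A (suc m)} → Increasing x → Increasing z → x ⊆ᵛ z →
                ∃ λ i → removeAt z i ≡ x
  ⊆ᵛ⇒removeAt {x = []}    {_ ∷ []}        _   _   _     = Fin.zero , refl
  ⊆ᵛ⇒removeAt {x = b ∷ x} {a ∷ z@(_ ∷ _)} bx↑ az↑ bx⊆az with ⊆ᵛ-step bx↑ az↑ bx⊆az
  ... | inj₁ (refl , x⊆z) =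
    let i , zᵢ≡x = ⊆ᵛ⇒removeAt (AllPairs.tail bx↑) (AllPairs.tail az↑) x⊆z in Fin.suc i , cong (b ∷_) zᵢ≡x
  ... | inj₂ bx⊆z = Fin.zero , sym (⊆ᵛ⇒≡ bx↑ (AllPairs.tail az↑) bx⊆z)

  removeAt-injective : ∀ {m} {z : Vec A (suc m)} → Increasing z → Injective _≡_ _≡_ (removeAt z)
  removeAt-injective {z = _ ∷ _}           _               {Fin.zero}  {Fin.zero}  _ = refl
  removeAt-injective {z = _ ∷ _ ∷ _}       ((a<c ∷ _) ∷ _) {Fin.zero}  {Fin.suc _} e =
    ⊥-elim (irrefl (sym (cong Vec.head e)) a<c)
  removeAt-injective {z = _ ∷ _ ∷ _}       ((a<c ∷ _) ∷ _) {Fin.suc _} {Fin.zero}  e =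
    ⊥-elim (irrefl (cong Vec.head e) a<c)
  removeAt-injective {z = _ ∷ z@(_ ∷ _)} (_ ∷ z↑)        {Fin.suc _} {Fin.suc _} e =
    cong Fin.suc (removeAt-injective z↑ (cong Vec.tail e))

open module SortedFin {n : ℕ} = SortedVec (Fin.<-isStrictTotalOrder {n})

private
  zero<map-suc : ∀ {n m} (v : Vec (Fin n) m) → All (Fin.zero {n} Fin.<_) (toList (Vec.map Fin.suc v))
  zero<map-suc []      = []
  zero<map-suc (_ ∷ v) = z<s ∷ zero<map-suc v

  map-suc-increasing : ∀ {n m} {v : Vec (Fin n) m} → Increasing v → Increasing (Vec.map Fin.suc v)
  map-suc-increasing {v = []}    []          = []
  map-suc-increasing {v = _ ∷ v} (a<v ∷ v↑) = above a<v ∷ map-suc-increasing v↑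
    where
    above : ∀ {m a} {v : Vec _ m} →
            All (a Fin.<_) (toList v) → All (Fin.suc a Fin.<_) (toList (Vec.map Fin.suc v))
    above {v = []}    []           = []
    above {v = _ ∷ _} (a<b ∷ a<v) = s<s a<b ∷ above a<v

  map-suc-injective : ∀ {n m} → Injective _≡_ _≡_ (Vec.map {n = m} (Fin.suc {n}))
  map-suc-injective {x = []}    {[]}    _ = refl
  map-suc-injective {x = _ ∷ _} {_ ∷ _} e =
    cong₂ _∷_ (Fin.suc-injective (cong Vec.head e)) (map-suc-injective (cong Vec.tail e))

incVecs-increasing : ∀ n m {v : Vec (Fin n) m} → v ∈ incVecs n m → Increasing v
incVecs-increasing n       zero    {[]} _ = []
incVecs-increasing (suc n) (suc m) v∈ with ∈-++⁻ (map (λ v → Fin.zero ∷ Vec.map Fin.suc v) (incVecs n m)) v∈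
... | inj₁ v∈₀ with ∈-map⁻ _ v∈₀
...   | w , w∈ , refl = zero<map-suc w ∷ map-suc-increasing (incVecs-increasing n m w∈)
incVecs-increasing (suc n) (suc m) v∈ | inj₂ v∈₊ with ∈-map⁻ _ v∈₊
...   | w , w∈ , refl = map-suc-increasing (incVecs-increasing n (suc m) w∈)

incVecs-unique : ∀ n m → Unique (incVecs n m)
incVecs-unique n       zero    = [] ∷ []
incVecs-unique zero    (suc m) = []
incVecs-unique (suc n) (suc m) =
  Unique.++⁺ (Unique.map⁺ (map-suc-injective ∘ cong Vec.tail) (incVecs-unique n m))
             (Unique.map⁺ map-suc-injective (incVecs-unique n (suc m)))
             disjoint
  where
  disjoint : ∀ {v} → ¬ (v ∈ map (λ v → Fin.zero ∷ Vec.map Fin.suc v) (incVecs n m)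
                        × v ∈ map (Vec.map Fin.suc) (incVecs n (suc m)))
  disjoint (v∈₀ , v∈₊) with ∈-map⁻ _ v∈₀ | ∈-map⁻ _ v∈₊
  ... | _ , _ , refl | _ ∷ _ , _ , ()

simplices-increasing : ∀ {n} (G : Graph n) k {x} → x ∈ simplices G k → Increasing x
simplices-increasing {n} G k x∈ = incVecs-increasing n (suc k) (proj₁ (∈-filter⁻ _ x∈))

simplices-unique : ∀ {n} (G : Graph n) k → Unique (simplices G k)
simplices-unique {n} G k = Unique.filter⁺ _ (incVecs-unique n (suc k))

restrict-δ : ∀ {n} (G : Graph n) k {x} → x ∈ simplices G k → ∀ w → restrict G k (δ x) w ≡ δ x w
restrict-δ G k x∈ w = Σℤ-kronecker _≟ᵥ_ (λ y → δ y w) (simplices G k) (simplices-unique G k) x∈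

dExt-cong : ∀ {n} k {f g : Ω n k} → (∀ w → f w ≡ g w) → ∀ z → dExt k f z ≡ dExt k g z
dExt-cong k f≗g z = Σℤ-cong (List.allFin _) λ {i} _ → cong (sgn (toℕ i) *_) (f≗g (removeAt z i))

dAdj-δ : ∀ {n} (G : Graph n) q {x} → x ∈ simplices G (suc q) →
         ∀ y → dAdj G q (restrict G (suc q) (δ x)) y ≡ dMat q x y
dAdj-δ G q x∈ y =
  trans (Σℤ-cong (simplices G (suc q)) λ {z} _ → cong (dMat q z y *_) (restrict-δ G (suc q) x∈ z))
        (Σℤ-kronecker _≟ᵥ_ (λ z → dMat q z y) (simplices G (suc q)) (simplices-unique G (suc q)) x∈)

dMat-removeAt : ∀ {n} p {z : Vec (Fin n) (suc (suc p))} → Increasing z →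
                ∀ i → dMat p z (removeAt z i) ≡ sgn (toℕ i)
dMat-removeAt p {z} z↑ = Σℤ-kronecker-injective _≟ᵥ_ (removeAt z) (removeAt-injective z↑) (sgn ∘ toℕ)

dMat-non-facet : ∀ {n} p {z : Vec (Fin n) (suc (suc p))} {x} →
                 (∀ i → x ≢ removeAt z i) → dMat p z x ≡ + 0
dMat-non-facet p x≢zᵢ =
  Σℤ-zero (List.allFin _) λ {i} _ →
    trans (cong (sgn (toℕ i) *_) (kronecker-≢ _≟ᵥ_ (x≢zᵢ i))) (ℤ.*-zeroʳ (sgn (toℕ i)))

dMat-squared : ∀ {n} p {z : Vec (Fin n) (suc (suc p))} {x} → Increasing z → Increasing x →
               dMat p z x * dMat p z x ≡ (if subB x z then + 1 else + 0)
dMat-squared p {z} {x} z↑ x↑ with subB x z in x⊆?z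
... | true with ⊆ᵛ⇒removeAt x↑ z↑ (subB-sound x z x⊆?z)
...   | i , refl rewrite dMat-removeAt p z↑ i = sgn-*-sgn (toℕ i)
dMat-squared p {z} {x} z↑ x↑ | false = cong₂ _*_ dMat≡0 dMat≡0
  where
  dMat≡0 : dMat p z x ≡ + 0
  dMat≡0 = dMat-non-facet p {z} {x} λ { i refl → subB-false⇒⊈ᵛ x z x⊆?z (removeAt-⊆ᵛ z i) }

up-Laplacian-diagonal : ∀ {n} (G : Graph n) p {x} → x ∈ simplices G p →
                        dAdj G p (dExt p (restrict G p (δ x))) x ≡ + deg G p x
up-Laplacian-diagonal G p {x} x∈ = begin
  Σℤ (map (λ z → dMat p z x * dExt p (restrict G p (δ x)) z) (simplices G (suc p)))
    ≡⟨ Σℤ-cong (simplices G (suc p)) (λ {z} z∈ →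
         trans (cong (dMat p z x *_) (dExt-cong p (restrict-δ G p x∈) z))
               (dMat-squared p (simplices-increasing G (suc p) z∈) (simplices-increasing G p x∈))) ⟩
  Σℤ (map (λ z → if subB x z then + 1 else + 0) (simplices G (suc p)))
    ≡⟨ Σℤ-indicator (subB x) (simplices G (suc p)) ⟩
  + deg G p x ∎
  where open ≡-Reasoning

down-Laplacian-diagonal : ∀ {n} (G : Graph n) q {x} → x ∈ simplices G (suc q) →
                          dExt q (dAdj G q (restrict G (suc q) (δ x))) x ≡ + suc (suc q)
down-Laplacian-diagonal G q {x} x∈ = begin
  dExt q (dAdj G q (restrict G (suc q) (δ x))) x
    ≡⟨ dExt-cong q (dAdj-δ G q x∈) x ⟩
  Σℤ (map (λ i → sgn (toℕ i) * dMat q x (removeAt x i)) (List.allFin (suc (suc q))))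
    ≡⟨ Σℤ-cong (List.allFin _) (λ {i} _ →
         trans (cong (sgn (toℕ i) *_) (dMat-removeAt q (simplices-increasing G (suc q) x∈) i))
               (sgn-*-sgn (toℕ i))) ⟩
  Σℤ (map (λ _ → + 1) (List.allFin (suc (suc q))))
    ≡⟨ Σℤ-ones (List.allFin (suc (suc q))) ⟩
  + length (List.allFin (suc (suc q)))
    ≡⟨ cong +_ (List.length-tabulate id) ⟩
  + suc (suc q) ∎
  where open ≡-Reasoning

mainTheorem10 : ∀ {n} (G : Graph n) (p : ℕ) (x : Vec (Fin n) (suc p)) →
    x ∈ simplices G p →
    (p > 0 → + deg G p x ≡ Ldiag G p x - + (suc p))
    × (p ≡ 0 → + deg G p x ≡ Ldiag G p x)
mainTheorem10 G zero    x x∈ = (λ ()) , λ _ → sym (up-Laplacian-diagonal G zero x∈)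
mainTheorem10 G (suc q) x x∈ = (λ _ → begin
  + deg G (suc q) x                                   ≡⟨ //-rightDividesʳ (+ suc (suc q)) _ ⟨
  + deg G (suc q) x + + suc (suc q) - + suc (suc q)
    ≡⟨ cong (_- + suc (suc q)) (cong₂ _+_ (up-Laplacian-diagonal G (suc q) x∈)
                                          (down-Laplacian-diagonal G q x∈)) ⟨
  Ldiag G (suc q) x - + suc (suc q)                   ∎) , λ ()
  where open ≡-Reasoning
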